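{- Let $n\ge 3$ and let $\mathcal{S}_n$ be the set of integer solutions, identified up to permutation of coordinates, of $\left(\sum_i x_i\right)^2-\sum_i x_i-4\sum_{1\le i<j\le n}x_ix_j=0$, viewed as a graph with two elements adjacent if (for suitable orderings) they differ in exactly one coordinate. For $\mathbf{a}\in\mathbb{Z}^{n-3}$ write $s=s(\mathbf{a})=\sum_i a_i$ and $\|\mathbf{a}\|^2=\sum_i a_i^2$. Then the $n$-tuples $$\mathbf{r}_+=(s^2+\|\mathbf{a}\|^2,\ s^2+\|\mathbf{a}\|^2,\ -s,\ \mathbf{a}),\qquad \mathbf{r}_-=(-(s+1)^2-\|\mathbf{a}\|^2,\ -(s+1)^2-\|\mathbf{a}\|^2,\ -(s+1),\ \mathbf{a})$$ are elements of $\mathcal{S}_n$ which are roots, $\mathbf{r}_+$ being positive and $\mathbf{r}_-$ negative. In particular every $(n-3)$-tuple of integers can be extended to a root of $\mathcal{S}_n$.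
   Context: The height of $\mathbf{x}\in\mathcal{S}_n$ is $\left|1+\sum_i x_i\right|$; a root is a vertex all of whose neighbors have greater height. An element $\mathbf{x}$ is positive (resp. negative) if $\sum_i x_i+1>0$ (resp. $<0$). When $n=3$, $\mathbf{a}$ is empty with $s=\|\mathbf{a}\|^2=0$; the trailing "$\mathbf{a}$" means the coordinates of $\mathbf{a}$ are appended. -}

module Defs where

open import Data.Nat using (ℕ; suc)
open import Data.Integer using (ℤ; +_; _+_; _*_; -_; _-_; _<_; ∣_∣)
import Data.Nat as ℕ
open import Data.Vec using (Vec; []; _∷_; lookup; map)
open import Data.Fin using (Fin)
open import Data.Fin.Permutation using (Permutation′; _⟨$⟩ʳ_)
open import Data.Product using (Σ; ∃; ∃-syntax; _×_)
open import Relation.Binary.PropositionalEquality using (_≡_; _≢_)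

sum : ∀ {n} → Vec ℤ n → ℤ
sum [] = + 0
sum (x ∷ xs) = x + sum xs

pairSum : ∀ {n} → Vec ℤ n → ℤ
pairSum [] = + 0
pairSum (x ∷ xs) = x * sum xs + pairSum xs

Solution : ∀ {n} → Vec ℤ n → Set
Solution x = sum x * sum x - sum x - + 4 * pairSum x ≡ + 0

height : ∀ {n} → Vec ℤ n → ℕ
height x = ∣ + 1 + sum x ∣

-- adjacency in S_n (elements up to permutation): after reordering y,
-- x and y differ in exactly one coordinate
Adjacent : ∀ {n} → Vec ℤ n → Vec ℤ n → Set
Adjacent {n} x y =
  Σ (Permutation′ n) λ σ → ∃[ i ] (lookup y (σ ⟨$⟩ʳ i) ≢ lookup x i
     × (∀ j → j ≢ i → lookup y (σ ⟨$⟩ʳ j) ≡ lookup x j))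

Root : ∀ {n} → Vec ℤ n → Set
Root {n} x = ∀ (y : Vec ℤ n) → Solution y → Adjacent x y → height x ℕ.< height y

Positive : ∀ {n} → Vec ℤ n → Set
Positive x = + 0 < + 1 + sum x

Negative : ∀ {n} → Vec ℤ n → Set
Negative x = + 1 + sum x < + 0

normSq : ∀ {m} → Vec ℤ m → ℤ
normSq a = sum (map (λ t → t * t) a)

rPlus : ∀ {m} → Vec ℤ m → Vec ℤ (3 ℕ.+ m)
rPlus a = let s = sum a ; t = s * s + normSq a in t ∷ t ∷ - s ∷ a

rMinus : ∀ {m} → Vec ℤ m → Vec ℤ (3 ℕ.+ m)
rMinus a = let s = sum a ; u = - ((s + + 1) * (s + + 1)) - normSq a
           in u ∷ u ∷ - (s + + 1) ∷ a

-- A solution x with h = 1 + Σ x is a root as soon as every coordinate jump strictly increases |h|.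
-- Fixing all coordinates but one, u, the equation becomes 2(P + u²) = (R + u)² + (R + u), a quadratic
-- in u whose two roots sum to 2R + 1 (R, P: sum and sum of squares of the other coordinates). So the
-- only neighbour through that coordinate replaces u by 2R + 1 - u, shifting Σ x by 2(R - u) + 1.
-- In r₊ every coordinate is at most the sum R of the others (because a ≤ a² and -s ≤ s²), so all
-- jumps raise the positive h; in r₋ every coordinate exceeds R, so all jumps lower the negative h.
module Submission where

open import Defs
open import Data.Nat using (ℕ)
open import Data.Integer using (ℤ)
open import Data.Vec using (Vec; drop)
open import Data.Product using (_×_; ∃-syntax)
open import Relation.Binary.PropositionalEquality using (_≡_)

import Data.Nat as ℕ
open import Data.Nat.Properties using (m≤m*n)
open import Data.Integer using (+_; -[1+_]; _+_; _*_; -_; _-_; _<_; _≤_; ∣_∣; +≤+; -≤+; +<+; nonNegative)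
open import Data.Integer.Properties
open import Data.Integer.Tactic.RingSolver using (solve-∀)
open import Data.Vec using ([]; _∷_; lookup; map)
open import Data.Vec.Properties using (lookup-map)
open import Data.Vec.Functional using (removeAt)
open import Data.Fin using (Fin; zero; suc; punchIn)
open import Data.Fin.Properties using (punchInᵢ≢i)
open import Data.Fin.Permutation using (_⟨$⟩ʳ_)
open import Data.Product using (_,_)
open import Data.Sum using (_⊎_; inj₁; inj₂) renaming (map to ⊎-map)
open import Data.Empty using (⊥-elim)
open import Function.Bundles using (_⇔_; mk⇔; Equivalence)
open import Relation.Binary.PropositionalEquality
  using (_≢_; refl; sym; trans; cong; cong₂; subst; subst₂; module ≡-Reasoning)
import Algebra.Properties.CommutativeMonoid.Sum as CommutativeMonoidSum
open CommutativeMonoidSum +-0-commutativeMonoid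
  using (sum-remove; sum-cong-≗; sum-permute) renaming (sum to ∑)
open Equivalence using (to; from)

i≤i*i : ∀ i → i ≤ i * i
i≤i*i (+ ℕ.zero)  = ≤-refl
i≤i*i (+ ℕ.suc n) = +≤+ (m≤m*n (ℕ.suc n) (ℕ.suc n))
i≤i*i -[1+ n ]    = -≤+

-i≤i*i : ∀ i → - i ≤ i * i
-i≤i*i i = subst (- i ≤_) (neg-square i) (i≤i*i (- i))
  where
  neg-square : ∀ i → (- i) * (- i) ≡ i * i
  neg-square = solve-∀

0≤i*i : ∀ i → + 0 ≤ i * i
0≤i*i (+ ℕ.zero)  = ≤-refl
0≤i*i (+ ℕ.suc n) = +≤+ ℕ.z≤n
0≤i*i -[1+ n ]    = +≤+ ℕ.z≤n

i<i+j : ∀ i {j} → + 0 < j → i < i + j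
i<i+j i 0<j = subst (_< i + _) (+-identityʳ i) (+-monoʳ-< i 0<j)

0<1+2i : ∀ {i} → + 0 ≤ i → + 0 < + 1 + + 2 * i
0<1+2i 0≤i = +-mono-<-≤ (+<+ (ℕ.s≤s ℕ.z≤n)) (*-monoˡ-≤-nonNeg (+ 2) 0≤i)

0<i<j⇒∣i∣<∣j∣ : ∀ {i j} → + 0 < i → i < j → ∣ i ∣ ℕ.< ∣ j ∣
0<i<j⇒∣i∣<∣j∣ {+ _} {+ _}     _ (+<+ m<n) = m<n
0<i<j⇒∣i∣<∣j∣ {+ _} { -[1+ _ ]} _ ()

j<i<0⇒∣i∣<∣j∣ : ∀ {i j} → i < + 0 → j < i → ∣ i ∣ ℕ.< ∣ j ∣
j<i<0⇒∣i∣<∣j∣ {i} {j} i<0 j<i =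
  subst₂ ℕ._<_ (∣-i∣≡∣i∣ i) (∣-i∣≡∣i∣ j) (0<i<j⇒∣i∣<∣j∣ (neg-mono-< i<0) (neg-mono-< j<i))

0≤normSq : ∀ {m} (a : Vec ℤ m) → + 0 ≤ normSq a
0≤normSq []       = ≤-refl
0≤normSq (x ∷ xs) = +-mono-≤ (0≤i*i x) (0≤normSq xs)

lookup²≤normSq : ∀ {m} (a : Vec ℤ m) j → lookup a j * lookup a j ≤ normSq a
lookup²≤normSq (x ∷ xs) zero    = i≤i+j (x * x) (normSq xs) {{nonNegative (0≤normSq xs)}}
lookup²≤normSq (x ∷ xs) (suc j) =
  ≤-trans (lookup²≤normSq xs j) (i≤j+i (normSq xs) (x * x) {{nonNegative (0≤i*i x)}})

-sum≤normSq : ∀ {m} (a : Vec ℤ m) → - sum a ≤ normSq a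
-sum≤normSq []       = ≤-refl
-sum≤normSq (x ∷ xs) =
  subst (_≤ normSq (x ∷ xs)) (sym (neg-distrib-+ x (sum xs))) (+-mono-≤ (-i≤i*i x) (-sum≤normSq xs))

sum≡∑lookup : ∀ {n} (x : Vec ℤ n) → sum x ≡ ∑ (lookup x)
sum≡∑lookup []       = refl
sum≡∑lookup (x ∷ xs) = cong (_+_ x) (sum≡∑lookup xs)

normSq≡∑lookup² : ∀ {n} (x : Vec ℤ n) → normSq x ≡ ∑ (λ i → lookup x i * lookup x i)
normSq≡∑lookup² x = trans (sum≡∑lookup (map _ x)) (sum-cong-≗ (λ i → lookup-map i _ x))

∑-splitAt : ∀ {n} {f g : Fin (ℕ.suc n) → ℤ} i → (∀ j → j ≢ i → f j ≡ g j) →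
            ∑ f ≡ f i + ∑ (removeAt g i)
∑-splitAt {f = f} i f≡g =
  trans (sum-remove f) (cong (_+_ (f i)) (sum-cong-≗ (λ j → f≡g (punchIn i j) (punchInᵢ≢i i j))))

sum²≡normSq+2*pairSum : ∀ {n} (x : Vec ℤ n) → sum x * sum x ≡ normSq x + + 2 * pairSum x
sum²≡normSq+2*pairSum []       = refl
sum²≡normSq+2*pairSum (x ∷ xs) = begin
  (x + S) * (x + S)                                ≡⟨ expand x S ⟩
  x * x + + 2 * x * S + S * S                      ≡⟨ cong (λ T → x * x + + 2 * x * S + T) (sum²≡normSq+2*pairSum xs) ⟩
  x * x + + 2 * x * S + (normSq xs + + 2 * P)      ≡⟨ regroup x S (normSq xs) P ⟩
  (x * x + normSq xs) + + 2 * (x * S + P)          ∎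
  where
  open ≡-Reasoning
  S = sum xs
  P = pairSum xs
  expand : ∀ x S → (x + S) * (x + S) ≡ x * x + + 2 * x * S + S * S
  expand = solve-∀
  regroup : ∀ x S Q P → x * x + + 2 * x * S + (Q + + 2 * P) ≡ (x * x + Q) + + 2 * (x * S + P)
  regroup = solve-∀

solution⇔ : ∀ {n} (x : Vec ℤ n) → Solution x ⇔ (+ 2 * normSq x ≡ sum x * sum x + sum x)
solution⇔ x = mk⇔ (λ e → i-j≡0⇒i≡j _ _ (trans (sym equation≡) e)) (λ e → trans equation≡ (i≡j⇒i-j≡0 e))
  where
  open ≡-Reasoning
  S = sum x
  Q = normSq x
  P = pairSum x
  equation≡ : S * S - S - + 4 * P ≡ + 2 * Q - (S * S + S)
  equation≡ = begin
    S * S - S - + 4 * P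
      ≡⟨ rearrange S Q P ⟩
    (+ 2 * Q - (S * S + S)) + + 2 * (S * S - (Q + + 2 * P))
      ≡⟨ cong (λ d → (+ 2 * Q - (S * S + S)) + + 2 * d) (i≡j⇒i-j≡0 (sum²≡normSq+2*pairSum x)) ⟩
    (+ 2 * Q - (S * S + S)) + + 0
      ≡⟨ +-identityʳ _ ⟩
    + 2 * Q - (S * S + S)
      ∎
    where
    rearrange : ∀ S Q P → S * S - S - + 4 * P ≡ (+ 2 * Q - (S * S + S)) + + 2 * (S * S - (Q + + 2 * P))
    rearrange = solve-∀

vieta : ∀ R P u v →
  + 2 * (u * u + P) ≡ (u + R) * (u + R) + (u + R) →
  + 2 * (v * v + P) ≡ (v + R) * (v + R) + (v + R) →
  v ≡ u ⊎ v ≡ + 2 * R + + 1 - u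
vieta R P u v eu ev = ⊎-map (i-j≡0⇒i≡j v u) (i-j≡0⇒i≡j v _) (i*j≡0⇒i≡0∨j≡0 (v - u) product≡0)
  where
  factorise : ∀ R P u v →
    (v - u) * (v - (+ 2 * R + + 1 - u)) ≡
    (+ 2 * (v * v + P) - ((v + R) * (v + R) + (v + R))) - (+ 2 * (u * u + P) - ((u + R) * (u + R) + (u + R)))
  factorise = solve-∀
  product≡0 : (v - u) * (v - (+ 2 * R + + 1 - u)) ≡ + 0
  product≡0 = trans (factorise R P u v) (cong₂ _-_ (i≡j⇒i-j≡0 ev) (i≡j⇒i-j≡0 eu))

jump-shift : ∀ R P u v → v ≢ u →
  + 2 * (u * u + P) ≡ (u + R) * (u + R) + (u + R) →
  + 2 * (v * v + P) ≡ (v + R) * (v + R) + (v + R) →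
  v + R ≡ (u + R) + (+ 1 + + 2 * ((u + R) - + 2 * u))
jump-shift R P u v v≢u eu ev with vieta R P u v eu ev
... | inj₁ v≡u           = ⊥-elim (v≢u v≡u)
... | inj₂ v≡2R+1-u = trans (cong (λ w → w + R) v≡2R+1-u) (regroup R u)
  where
  regroup : ∀ R u → (+ 2 * R + + 1 - u) + R ≡ (u + R) + (+ 1 + + 2 * ((u + R) - + 2 * u))
  regroup = solve-∀

sum-after-jump : ∀ {n} (x y : Vec ℤ n) → Solution x → Solution y → Adjacent x y →
  ∃[ i ] sum y ≡ sum x + (+ 1 + + 2 * (sum x - + 2 * lookup x i))
sum-after-jump {ℕ.suc n} x y sx sy (σ , i , v≢u , others) = i , (begin
  sum y                                        ≡⟨ sumʸ ⟩
  v + R                                        ≡⟨ jump-shift R P u v v≢u (split x u sx sumˣ normSqˣ) (split y v sy sumʸ normSqʸ) ⟩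
  (u + R) + (+ 1 + + 2 * ((u + R) - + 2 * u)) ≡⟨ cong (λ S → S + (+ 1 + + 2 * (S - + 2 * u))) (sym sumˣ) ⟩
  sum x + (+ 1 + + 2 * (sum x - + 2 * u))     ∎)
  where
  open ≡-Reasoning
  f = lookup x
  g = λ j → lookup y (σ ⟨$⟩ʳ j)
  u = f i
  v = g i
  R = ∑ (removeAt f i)
  P = ∑ (removeAt (λ j → f j * f j) i)
  sumˣ : sum x ≡ u + R
  sumˣ = trans (sum≡∑lookup x) (∑-splitAt {g = f} i (λ _ _ → refl))
  sumʸ : sum y ≡ v + R
  sumʸ = trans (sum≡∑lookup y) (trans (sum-permute (lookup y) σ) (∑-splitAt i others))
  normSqˣ : normSq x ≡ u * u + P
  normSqˣ = trans (normSq≡∑lookup² x) (∑-splitAt {g = λ j → f j * f j} i (λ _ _ → refl))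
  normSqʸ : normSq y ≡ v * v + P
  normSqʸ = trans (normSq≡∑lookup² y) (trans (sum-permute (λ j → lookup y j * lookup y j) σ)
                                             (∑-splitAt i (λ j j≢i → cong₂ _*_ (others j j≢i) (others j j≢i))))
  split : ∀ (z : Vec ℤ (ℕ.suc n)) w → Solution z → sum z ≡ w + R → normSq z ≡ w * w + P →
          + 2 * (w * w + P) ≡ (w + R) * (w + R) + (w + R)
  split z w sz s≡ q≡ = subst₂ (λ Q S → + 2 * Q ≡ S * S + S) q≡ s≡ (to (solution⇔ z) sz)

positive-root : ∀ {n} (x : Vec ℤ n) → Solution x → Positive x →
  (∀ i → + 2 * lookup x i ≤ sum x) → Root x
positive-root x sx pos 2xᵢ≤Σx y sy adj with sum-after-jump x y sx sy adj
... | i , Σy≡ = 0<i<j⇒∣i∣<∣j∣ pos (+-monoʳ-< (+ 1) Σx<Σy)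
  where
  Σx<Σy : sum x < sum y
  Σx<Σy = subst (sum x <_) (sym Σy≡) (i<i+j (sum x) (0<1+2i (i≤j⇒0≤j-i (2xᵢ≤Σx i))))

negative-root : ∀ {n} (x : Vec ℤ n) → Solution x → Negative x →
  (∀ i → + 1 + sum x ≤ + 2 * lookup x i) → Root x
negative-root x sx neg 1+Σx≤2xᵢ y sy adj with sum-after-jump x y sx sy adj
... | i , Σy≡ = j<i<0⇒∣i∣<∣j∣ neg (+-monoʳ-< (+ 1) Σy<Σx)
  where
  u = lookup x i
  e = + 2 * u - (+ 1 + sum x)
  regroup : ∀ S u → (S + (+ 1 + + 2 * (S - + 2 * u))) + (+ 1 + + 2 * (+ 2 * u - (+ 1 + S))) ≡ S
  regroup = solve-∀
  Σy+odd≡Σx : sum y + (+ 1 + + 2 * e) ≡ sum x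
  Σy+odd≡Σx = trans (cong (λ T → T + (+ 1 + + 2 * e)) Σy≡) (regroup (sum x) u)
  Σy<Σx : sum y < sum x
  Σy<Σx = subst (sum y <_) Σy+odd≡Σx (i<i+j (sum y) (0<1+2i (i≤j⇒0≤j-i (1+Σx≤2xᵢ i))))

module _ {m} (a : Vec ℤ m) where

  private
    s = sum a
    q = normSq a

  rPlus-sum : sum (rPlus a) ≡ + 2 * (s * s + q)
  rPlus-sum = double s q
    where
    double : ∀ s q → (s * s + q) + ((s * s + q) + (- s + s)) ≡ + 2 * (s * s + q)
    double = solve-∀

  rPlus-solution : Solution (rPlus a)
  rPlus-solution = from (solution⇔ (rPlus a)) (begin
    + 2 * normSq (rPlus a)
      ≡⟨ identity s q ⟩
    + 2 * (s * s + q) * (+ 2 * (s * s + q)) + + 2 * (s * s + q)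
      ≡⟨ cong (λ S → S * S + S) (sym rPlus-sum) ⟩
    sum (rPlus a) * sum (rPlus a) + sum (rPlus a)
      ∎)
    where
    open ≡-Reasoning
    identity : ∀ s q → let t = s * s + q in
      + 2 * (t * t + (t * t + ((- s) * (- s) + q))) ≡ + 2 * t * (+ 2 * t) + + 2 * t
    identity = solve-∀

  rPlus-positive : Positive (rPlus a)
  rPlus-positive = subst (λ S → + 0 < + 1 + S) (sym rPlus-sum) (0<1+2i (+-mono-≤ (0≤i*i s) (0≤normSq a)))

  rPlus-coordinate≤ : ∀ i → lookup (rPlus a) i ≤ s * s + q
  rPlus-coordinate≤ zero                = ≤-refl
  rPlus-coordinate≤ (suc zero)          = ≤-refl
  rPlus-coordinate≤ (suc (suc zero))    = ≤-trans (-i≤i*i s) (i≤i+j (s * s) q {{nonNegative (0≤normSq a)}})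
  rPlus-coordinate≤ (suc (suc (suc j))) =
    ≤-trans (i≤i*i (lookup a j)) (≤-trans (lookup²≤normSq a j) (i≤j+i q (s * s) {{nonNegative (0≤i*i s)}}))

  rPlus-root : Root (rPlus a)
  rPlus-root = positive-root (rPlus a) rPlus-solution rPlus-positive λ i →
    subst (+ 2 * lookup (rPlus a) i ≤_) (sym rPlus-sum) (*-monoˡ-≤-nonNeg (+ 2) (rPlus-coordinate≤ i))

  private
    c = (s + + 1) * (s + + 1) + q

  0<c : + 0 < c
  0<c = subst (+ 0 <_) (sym (regroup s q))
          (+-mono-<-≤ (+<+ (ℕ.s≤s ℕ.z≤n)) (+-mono-≤ (i≤j⇒0≤j-i (-i≤i*i s)) (i≤j⇒0≤j-i (-sum≤normSq a))))
    where
    regroup : ∀ s q → (s + + 1) * (s + + 1) + q ≡ + 1 + ((s * s - - s) + (q - - s))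
    regroup = solve-∀

  1+rMinus-sum : + 1 + sum (rMinus a) ≡ + 2 * - c
  1+rMinus-sum = double s q
    where
    double : ∀ s q → let w = - ((s + + 1) * (s + + 1)) - q in
      + 1 + (w + (w + (- (s + + 1) + s))) ≡ + 2 * - ((s + + 1) * (s + + 1) + q)
    double = solve-∀

  rMinus-solution : Solution (rMinus a)
  rMinus-solution = from (solution⇔ (rMinus a)) (identity s q)
    where
    identity : ∀ s q → let w = - ((s + + 1) * (s + + 1)) - q ; S = w + (w + (- (s + + 1) + s)) in
      + 2 * (w * w + (w * w + ((- (s + + 1)) * (- (s + + 1)) + q))) ≡ S * S + S
    identity = solve-∀

  rMinus-negative : Negative (rMinus a)
  rMinus-negative = subst (_< + 0) (sym 1+rMinus-sum) (*-monoˡ-<-pos (+ 2) (neg-mono-< 0<c))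

  -c≤rMinus-coordinate : ∀ i → - c ≤ lookup (rMinus a) i
  -c≤rMinus-coordinate zero                = ≤-reflexive (neg-distrib-+ ((s + + 1) * (s + + 1)) q)
  -c≤rMinus-coordinate (suc zero)          = ≤-reflexive (neg-distrib-+ ((s + + 1) * (s + + 1)) q)
  -c≤rMinus-coordinate (suc (suc zero))    =
    neg-mono-≤ (≤-trans (i≤i*i (s + + 1)) (i≤i+j _ q {{nonNegative (0≤normSq a)}}))
  -c≤rMinus-coordinate (suc (suc (suc j))) = subst (- c ≤_) (neg-involutive aⱼ) (neg-mono-≤
    (≤-trans (-i≤i*i aⱼ) (≤-trans (lookup²≤normSq a j) (i≤j+i q _ {{nonNegative (0≤i*i (s + + 1))}}))))
    where aⱼ = lookup a j

  rMinus-root : Root (rMinus a)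
  rMinus-root = negative-root (rMinus a) rMinus-solution rMinus-negative λ i →
    subst (_≤ + 2 * lookup (rMinus a) i) (sym 1+rMinus-sum) (*-monoˡ-≤-nonNeg (+ 2) (-c≤rMinus-coordinate i))

proposition4p7 : (m : ℕ) (a : Vec ℤ m) →
    (Solution (rPlus a) × Root (rPlus a) × Positive (rPlus a))
    × (Solution (rMinus a) × Root (rMinus a) × Negative (rMinus a))
    × (∃[ r ] (Solution {3 Data.Nat.+ m} r × Root r × drop 3 r ≡ a))
proposition4p7 m a =
    (rPlus-solution a , rPlus-root a , rPlus-positive a)
  , (rMinus-solution a , rMinus-root a , rMinus-negative a)
  , (rPlus a , rPlus-solution a , rPlus-root a , refl)
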